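{- Let $R$ be a finite commutative ring with identity. If $R$ is not isomorphic to $\mathbb{Z}_2 \times D$ for any integral domain $D$, then $\gamma_t(\Gamma(R)) = \gamma(\Gamma(R))$.
   Context: For a commutative ring $R$ with identity, $Z(R)$ denotes its set of zero-divisors and $Z(R)^* = Z(R)\setminus\{0\}$. The zero-divisor graph $\Gamma(R)$ has vertex set $Z(R)^*$; distinct vertices $r,s$ are adjacent iff $rs=0$, and a vertex $x$ is regarded as adjacent to itself iff $x^2=0$. A set $X \subseteq Z(R)^*$ is a dominating set if every vertex not in $X$ is adjacent to some element of $X$; it is a total dominating set if every vertex $v$ (including those in $X$) is adjacent to some $x \in X$ (with $x=v$ allowed only when $v^2=0$). $\gamma(\Gamma(R))$ and $\gamma_t(\Gamma(R))$ denote the minimum cardinalities of a dominating set and a total dominating set, respectively. -}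

module Defs where

open import Level using (Level; _⊔_; 0ℓ)
open import Data.Nat using (ℕ; _<_)
open import Data.Fin using (Fin)
open import Data.Bool.Properties using (xor-∧-commutativeRing)
open import Data.Product using (Σ; ∃; ∃-syntax; _×_; _,_)
open import Data.Sum using (_⊎_)
open import Relation.Nullary using (¬_)
open import Relation.Binary.PropositionalEquality as ≡ using (_≡_)
open import Function.Bundles using (Inverse)
open import Algebra.Bundles using (CommutativeRing)
import Algebra.Construct.DirectProduct as DP
open import Algebra.Morphism.Structures using (module RingMorphisms)

private variable c ℓ : Level

Finite : CommutativeRing c ℓ → Set (c ⊔ ℓ)
Finite R = ∃[ n ] Inverse (≡.setoid (Fin n)) (CommutativeRing.setoid R)

IsIntegralDomain : CommutativeRing c ℓ → Set (c ⊔ ℓ)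
IsIntegralDomain D = ¬ (1# ≈ 0#) × (∀ x y → x * y ≈ 0# → x ≈ 0# ⊎ y ≈ 0#)
  where open CommutativeRing D

ℤ₂ : CommutativeRing 0ℓ 0ℓ
ℤ₂ = xor-∧-commutativeRing

ℤ₂× : CommutativeRing c ℓ → CommutativeRing c ℓ
ℤ₂× D = DP.commutativeRing ℤ₂ D

_≅ʳ_ : CommutativeRing c ℓ → CommutativeRing c ℓ → Set (c ⊔ ℓ)
R ≅ʳ S = ∃[ f ] RingMorphisms.IsRingIsomorphism
  (CommutativeRing.rawRing R) (CommutativeRing.rawRing S) f

module ZeroDivisorGraph (R : CommutativeRing c ℓ) where
  open CommutativeRing R

  IsZeroDivisor : Carrier → Set (c ⊔ ℓ)
  IsZeroDivisor x = ∃[ y ] (¬ (y ≈ 0#) × x * y ≈ 0#)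

  IsVertex : Carrier → Set (c ⊔ ℓ)
  IsVertex x = IsZeroDivisor x × ¬ (x ≈ 0#)

  Adj : Carrier → Carrier → Set ℓ
  Adj x y = (¬ (x ≈ y) × x * y ≈ 0#) ⊎ (x ≈ y × x * x ≈ 0#)

  record VertexSet (k : ℕ) : Set (c ⊔ ℓ) where
    field
      elt      : Fin k → Carrier
      vertex   : ∀ i → IsVertex (elt i)
      distinct : ∀ i j → elt i ≈ elt j → i ≡ j

  open VertexSet public

  _∈ˢ_ : ∀ {k} → Carrier → VertexSet k → Set ℓ
  v ∈ˢ X = ∃[ i ] v ≈ elt X i

  IsDominating : ∀ {k} → VertexSet k → Set (c ⊔ ℓ)
  IsDominating X = ∀ v → IsVertex v → ¬ (v ∈ˢ X) → ∃[ i ] Adj v (elt X i)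

  IsTotalDominating : ∀ {k} → VertexSet k → Set (c ⊔ ℓ)
  IsTotalDominating X = ∀ v → IsVertex v → ∃[ i ] Adj v (elt X i)

  IsDominationNumber : ℕ → Set (c ⊔ ℓ)
  IsDominationNumber k =
    (Σ (VertexSet k) IsDominating) ×
    (∀ m → m < k → ¬ Σ (VertexSet m) IsDominating)

  IsTotalDominationNumber : ℕ → Set (c ⊔ ℓ)
  IsTotalDominationNumber k =
    (Σ (VertexSet k) IsTotalDominating) ×
    (∀ m → m < k → ¬ Σ (VertexSet m) IsTotalDominating)

{-# OPTIONS --safe #-}

-- A finite commutative ring is the product of the local rings eR, e ranging over its
-- primitive idempotents. Every vertex v is nilpotent in some component pR, and then v
-- annihilates every nonzero w ∈ pR that is killed by the nilpotents of pR; such a w exists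
-- by descent. Some x in a dominating set X lies in pR or equals 1 - p, since x may be
-- taken to dominate the vertex 1 - p. Unless R has exactly two local factors, this
-- determines p from x, and replacing each x by the w of its component gives a total
-- dominating set no larger than X. With two local factors e and 1 - e, their two w's form
-- a total dominating set, while a single dominating vertex would be e or 1 - e and
-- adjacent to every other vertex, which forces R ≅ ℤ₂ × D with D a domain.

module Submission where

open import Level using (_⊔_)
open import Data.Bool using (Bool; true; false; _xor_; _∧_)
open import Data.Bool.Properties using (T-≡)
open import Data.Empty using (⊥; ⊥-elim)
open import Data.Fin using (Fin; zero; suc; toℕ)
import Data.Fin.Properties as Fin
open import Data.Fin.Subset using (Subset; _∈_; _⊂_)
open import Data.Fin.Subset.Induction using (⊂-wellFounded)
open import Data.Nat as ℕ using (ℕ; zero; suc; _≤_; z≤n; s≤s)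
import Data.Nat.Properties as ℕ
open import Data.Nat.Tactic.RingSolver using (solve-∀)
open import Data.Product using (Σ; ∃; _×_; _,_; proj₁; proj₂)
open import Data.Sum as Sum using (_⊎_; inj₁; inj₂; [_,_]′)
open import Data.Vec using (tabulate)
open import Data.Vec.Properties using (lookup∘tabulate; lookup⇒[]=; []=⇒lookup)
open import Function using (id; flip; _∘_; _on_; Equivalence)
open import Function.Bundles using (Inverse)
open import Function.Properties.Inverse using (Inverse⇒Injection)
import Function.Construct.Symmetry as Symmetry
open import Induction.WellFounded using (Acc; acc)
open import Relation.Nullary using (¬_; Dec; yes; no; does; contradiction)
open import Relation.Nullary.Decidable
  using (map′; isYes; toWitness; fromWitness; ¬?; _×-dec_; _⊎-dec_; decidable-stable)
open import Relation.Unary using (Pred; Decidable)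
open import Relation.Binary using (Setoid; _Respects_)
import Relation.Binary.Definitions as B
import Relation.Binary.Construct.On as On
open import Relation.Binary.PropositionalEquality as ≡ using (_≡_)
open import Algebra.Bundles using (CommutativeRing)

open import Defs

transition : ∀ {p} {P : Pred ℕ p} → Decidable P → ¬ P 0 → ∀ {t} → P t →
             ∃ λ j → ¬ P j × P (suc j)
transition P? ¬P0 {zero}  P0 = ⊥-elim (¬P0 P0)
transition P? ¬P0 {suc t} Pt with P? t
... | yes Pt′ = transition P? ¬P0 Pt′
... | no ¬Pt′ = t , ¬Pt′ , Pt

module FiniteSetoid {c ℓ n} (S : Setoid c ℓ) (enum : Inverse (≡.setoid (Fin n)) S) where
  open Setoid S
  open Inverse enum using (to; from; inverseˡ)

  infix 4 _≟_
  _≟_ : B.Decidable _≈_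
  _≟_ = Fin.inj⇒≟ (Inverse⇒Injection (Symmetry.inverse enum))

  to-from : ∀ x → to (from x) ≈ x
  to-from x = inverseˡ ≡.refl

  from-injective : ∀ {x y} → from x ≡ from y → x ≈ y
  from-injective {x} {y} same = trans (sym (to-from x)) (trans (reflexive (≡.cong to same)) (to-from y))

  module _ {p} {P : Pred Carrier p} (resp : P Respects _≈_) where

    any? : Decidable P → Dec (∃ P)
    any? P? = map′ (λ (i , Pi) → to i , Pi) (λ (x , px) → from x , resp (sym (to-from x)) px) (Fin.any? (P? ∘ to))

  ⟦_⟧ : ∀ {p} {P : Pred Carrier p} → Decidable P → Subset n
  ⟦ P? ⟧ = tabulate (isYes ∘ P? ∘ to)

  module _ {p} {P : Pred Carrier p} (P? : Decidable P) where

    ∈⟦⟧⁺ : ∀ {i} → P (to i) → i ∈ ⟦ P? ⟧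
    ∈⟦⟧⁺ {i} Pi = lookup⇒[]= i _
      (≡.trans (lookup∘tabulate _ i) (Equivalence.to T-≡ (fromWitness Pi)))

    ∈⟦⟧⁻ : ∀ {i} → i ∈ ⟦ P? ⟧ → P (to i)
    ∈⟦⟧⁻ {i} i∈ = toWitness (Equivalence.from T-≡
      (≡.trans (≡.sym (lookup∘tabulate _ i)) ([]=⇒lookup i∈)))

  ⟦⟧-⊂ : ∀ {p q} {P : Pred Carrier p} {Q : Pred Carrier q} (P? : Decidable P) (Q? : Decidable Q) →
         P Respects _≈_ → Q Respects _≈_ → (∀ {x} → P x → Q x) →
         ∀ {y} → Q y → ¬ P y → ⟦ P? ⟧ ⊂ ⟦ Q? ⟧
  ⟦⟧-⊂ P? Q? P-resp Q-resp P⇒Q {y} Qy ¬Py =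
    (λ i∈P → ∈⟦⟧⁺ Q? (P⇒Q (∈⟦⟧⁻ P? i∈P))) ,
    from y , ∈⟦⟧⁺ Q? (Q-resp (sym (to-from y)) Qy) , λ y∈P → ¬Py (P-resp (to-from y) (∈⟦⟧⁻ P? y∈P))

module IdempotentTheory {c ℓ} (R : CommutativeRing c ℓ) where
  open CommutativeRing R
  open import Algebra.Properties.Ring ring
    using (-0#≈0#; -‿injective; +-cancelˡ; -‿distribʳ-*; +-identityʳ-unique; x∙y⁻¹≈ε⇒x≈y; x[y-z]≈xy-xz; [y-z]x≈yx-zx)
  open import Algebra.Properties.CommutativeSemigroup *-commutativeSemigroup
    using (interchange; xy∙z≈xz∙y; x∙yz≈y∙zx)
  open import Algebra.Properties.CommutativeSemiring.Exp commutativeSemiring public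
    using (_^_; ^-congˡ; ^-congʳ; ^-homo-*; ^-assocʳ)
  open import Relation.Binary.Reasoning.Setoid setoid

  x-y≈0⇒x≈y : ∀ {x y} → x - y ≈ 0# → x ≈ y
  x-y≈0⇒x≈y = x∙y⁻¹≈ε⇒x≈y _ _

  x-y≈x⇒y≈0 : ∀ {x y} → x - y ≈ x → y ≈ 0#
  x-y≈x⇒y≈0 {x} {y} x-y≈x = -‿injective (trans (+-identityʳ-unique x (- y) x-y≈x) (sym -0#≈0#))

  IsIdempotent : Pred Carrier ℓ
  IsIdempotent e = e * e ≈ e

  IsProperSummand : Carrier → Pred Carrier ℓ
  IsProperSummand f g = IsIdempotent g × g * f ≈ g × g ≉ 0# × g ≉ f

  record IsPrimitive (e : Carrier) : Set (c ⊔ ℓ) where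
    field
      idempotent : IsIdempotent e
      nonzero    : e ≉ 0#
      minimal    : ∀ {g} → IsIdempotent g → g * e ≈ g → g ≈ 0# ⊎ g ≈ e

  module _ {f g} (f-idem : IsIdempotent f) (g≤f : g * f ≈ g) where

    difference-below : (f - g) * f ≈ f - g
    difference-below = trans ([y-z]x≈yx-zx f f g) (+-cong f-idem (-‿cong g≤f))

    difference-orthogonal : IsIdempotent g → (f - g) * g ≈ 0#
    difference-orthogonal g-idem = begin
      (f - g) * g    ≈⟨ [y-z]x≈yx-zx g f g ⟩
      f * g - g * g  ≈⟨ +-cong (trans (*-comm f g) g≤f) (-‿cong g-idem) ⟩
      g - g          ≈⟨ -‿inverseʳ g ⟩
      0#             ∎

    difference-idempotent : IsIdempotent g → IsIdempotent (f - g)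
    difference-idempotent g-idem = begin
      (f - g) * (f - g)          ≈⟨ x[y-z]≈xy-xz (f - g) f g ⟩
      (f - g) * f - (f - g) * g  ≈⟨ +-cong difference-below (-‿cong (difference-orthogonal g-idem)) ⟩
      (f - g) - 0#               ≈⟨ +-congˡ -0#≈0# ⟩
      (f - g) + 0#               ≈⟨ +-identityʳ (f - g) ⟩
      f - g                      ∎

    complementary-summand : IsProperSummand f g → IsProperSummand f (f - g)
    complementary-summand (g-idem , _ , g≉0 , g≉f) =
      difference-idempotent g-idem , difference-below ,
      (λ f-g≈0 → g≉f (sym (x-y≈0⇒x≈y f-g≈0))) , (λ f-g≈f → g≉0 (x-y≈x⇒y≈0 f-g≈f))

  multiple-below : ∀ {e} → IsIdempotent e → ∀ x → (e * x) * e ≈ e * x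
  multiple-below {e} e-idem x = trans (xy∙z≈xz∙y e x e) (*-congʳ e-idem)

  power-below : ∀ {e} → IsIdempotent e → ∀ x s → (e * x) ^ suc s * e ≈ (e * x) ^ suc s
  power-below e-idem x s = trans (xy∙z≈xz∙y _ _ _) (*-congʳ (multiple-below e-idem x))

  primitive⇒no-proper-summand : ∀ {e} → IsPrimitive e → ¬ ∃ (IsProperSummand e)
  primitive⇒no-proper-summand e-prim (g , g-idem , g≤e , g≉0 , g≉e) =
    [ g≉0 , g≉e ]′ (IsPrimitive.minimal e-prim g-idem g≤e)

  primitive-below-primitive : ∀ {p e} → IsPrimitive p → IsPrimitive e → p * e ≈ p → p ≈ e
  primitive-below-primitive p-prim e-prim p≤e =
    [ flip contradiction (IsPrimitive.nonzero p-prim) , id ]′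
      (IsPrimitive.minimal e-prim (IsPrimitive.idempotent p-prim) p≤e)

  primitive-orthogonal : ∀ {e f} → IsPrimitive e → IsPrimitive f → e ≉ f → e * f ≈ 0#
  primitive-orthogonal {e} {f} e-prim f-prim e≉f =
    [ id , (λ ef≈e → contradiction (primitive-below-primitive e-prim f-prim ef≈e) e≉f) ]′
      (IsPrimitive.minimal e-prim ef-idem (multiple-below e-idem f))
    where
    e-idem = IsPrimitive.idempotent e-prim
    ef-idem : IsIdempotent (e * f)
    ef-idem = trans (interchange e f e f) (*-cong e-idem (IsPrimitive.idempotent f-prim))

  isPrimitive-resp : IsPrimitive Respects _≈_
  isPrimitive-resp {e} {e′} e≈e′ e-prim = record
    { idempotent = trans (*-cong (sym e≈e′) (sym e≈e′)) (trans E.idempotent e≈e′)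
    ; nonzero    = λ e′≈0 → E.nonzero (trans e≈e′ e′≈0)
    ; minimal    = λ g-idem g≤e′ →
        Sum.map₂ (flip trans e≈e′) (E.minimal g-idem (trans (*-congˡ e≈e′) g≤e′))
    }
    where module E = IsPrimitive e-prim

  complement-idempotent : ∀ {e} → IsIdempotent e → IsIdempotent (1# - e)
  complement-idempotent = difference-idempotent (*-identityˡ 1#) (*-identityʳ _)

  complement-orthogonal : ∀ {e} → IsIdempotent e → (1# - e) * e ≈ 0#
  complement-orthogonal = difference-orthogonal (*-identityˡ 1#) (*-identityʳ _)

  +-complement : ∀ e → e + (1# - e) ≈ 1#
  +-complement e = begin
    e + (1# + - e)  ≈⟨ +-comm e _ ⟩
    1# + - e + e    ≈⟨ +-assoc 1# (- e) e ⟩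
    1# + (- e + e)  ≈⟨ +-congˡ (-‿inverseˡ e) ⟩
    1# + 0#         ≈⟨ +-identityʳ 1# ⟩
    1#              ∎

  complement-split : ∀ e x → e * x + (1# - e) * x ≈ x
  complement-split e x = begin
    e * x + (1# - e) * x  ≈⟨ distribʳ x e (1# - e) ⟨
    (e + (1# - e)) * x    ≈⟨ *-congʳ (+-complement e) ⟩
    1# * x                ≈⟨ *-identityˡ x ⟩
    x                     ∎

  complement-split-zero : ∀ {e x} → e * x ≈ 0# → (1# - e) * x ≈ 0# → x ≈ 0#
  complement-split-zero {e} {x} ex≈0 [1-e]x≈0 = begin
    x                     ≈⟨ complement-split e x ⟨
    e * x + (1# - e) * x  ≈⟨ +-cong ex≈0 [1-e]x≈0 ⟩
    0# + 0#               ≈⟨ +-identityˡ 0# ⟩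
    0#                    ∎

  complement-injective : ∀ {e p} → 1# - e ≈ 1# - p → e ≈ p
  complement-injective {e} {p} eq = -‿injective (+-cancelˡ 1# (- e) (- p) eq)

  complement-fixes : ∀ {e x} → e * x ≈ 0# → (1# - e) * x ≈ x
  complement-fixes {e} {x} ex≈0 = begin
    (1# - e) * x    ≈⟨ [y-z]x≈yx-zx x 1# e ⟩
    1# * x - e * x  ≈⟨ +-cong (*-identityˡ x) (trans (-‿cong ex≈0) -0#≈0#) ⟩
    x + 0#          ≈⟨ +-identityʳ x ⟩
    x               ∎

  complement-kills⇒below : ∀ {e x} → (1# - e) * x ≈ 0# → x * e ≈ x
  complement-kills⇒below {e} {x} [1-e]x≈0 = sym (x-y≈0⇒x≈y (begin
    x - x * e       ≈⟨ +-cong (*-identityˡ x) (-‿cong (*-comm e x)) ⟨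
    1# * x - e * x  ≈⟨ [y-z]x≈yx-zx x 1# e ⟨
    (1# - e) * x    ≈⟨ [1-e]x≈0 ⟩
    0#              ∎))

  Nilpotent : Pred Carrier ℓ
  Nilpotent x = ∃ λ t → x ^ t ≈ 0#

  nilpotent-resp : Nilpotent Respects _≈_
  nilpotent-resp x≈y (t , xᵗ≈0) = t , trans (^-congˡ t (sym x≈y)) xᵗ≈0

  -- m = (p+1)(i+1) is a multiple of the period p+1 and at least i+1.
  periodic⇒idempotent : ∀ a i p → a ^ suc i ≈ a ^ (suc i ℕ.+ suc p) →
                        IsIdempotent (a ^ (suc p ℕ.* suc i))
  periodic⇒idempotent a i p period = begin
    a ^ m * a ^ m                   ≈⟨ ^-homo-* a m m ⟨
    a ^ (m ℕ.+ m)                   ≡⟨ ≡.cong (a ^_) (rearrange p i) ⟩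
    a ^ (p ℕ.* suc i ℕ.+ (suc i ℕ.+ suc i ℕ.* suc p))
                                    ≈⟨ ^-homo-* a (p ℕ.* suc i) _ ⟩
    a ^ (p ℕ.* suc i) * a ^ (suc i ℕ.+ suc i ℕ.* suc p)
                                    ≈⟨ *-congˡ (stable (suc i)) ⟩
    a ^ (p ℕ.* suc i) * a ^ suc i   ≈⟨ ^-homo-* a (p ℕ.* suc i) (suc i) ⟨
    a ^ (p ℕ.* suc i ℕ.+ suc i)     ≡⟨ ≡.cong (a ^_) (ℕ.+-comm (p ℕ.* suc i) (suc i)) ⟩
    a ^ m                           ∎
    where
    m = suc p ℕ.* suc i
    rearrange : ∀ p i → suc p ℕ.* suc i ℕ.+ suc p ℕ.* suc i ≡
                        p ℕ.* suc i ℕ.+ (suc i ℕ.+ suc i ℕ.* suc p)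
    rearrange = solve-∀
    stable : ∀ k → a ^ (suc i ℕ.+ k ℕ.* suc p) ≈ a ^ suc i
    stable zero    = ^-congʳ a (ℕ.+-identityʳ (suc i))
    stable (suc k) = begin
      a ^ (suc i ℕ.+ (suc p ℕ.+ k ℕ.* suc p))   ≡⟨ ≡.cong (a ^_) (ℕ.+-assoc (suc i) (suc p) _) ⟨
      a ^ (suc i ℕ.+ suc p ℕ.+ k ℕ.* suc p)     ≈⟨ ^-homo-* a (suc i ℕ.+ suc p) _ ⟩
      a ^ (suc i ℕ.+ suc p) * a ^ (k ℕ.* suc p) ≈⟨ *-congʳ period ⟨
      a ^ suc i * a ^ (k ℕ.* suc p)             ≈⟨ ^-homo-* a (suc i) _ ⟨
      a ^ (suc i ℕ.+ k ℕ.* suc p)               ≈⟨ stable k ⟩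
      a ^ suc i                                 ∎

  idempotent-^ : ∀ {b} → IsIdempotent b → ∀ t → b ^ suc t ≈ b
  idempotent-^ {b} b-idem zero    = *-identityʳ b
  idempotent-^ {b} b-idem (suc t) = trans (*-congˡ (idempotent-^ b-idem t)) b-idem

  idempotent-power-vanishes : ∀ {a} s → IsIdempotent (a ^ suc s) → Nilpotent a → a ^ suc s ≈ 0#
  idempotent-power-vanishes {a} s idem (t , aᵗ≈0) = begin
    a ^ suc s                  ≈⟨ idempotent-^ idem t ⟨
    (a ^ suc s) ^ suc t        ≈⟨ ^-assocʳ a (suc s) (suc t) ⟩
    a ^ (suc s ℕ.* suc t)      ≡⟨ ≡.cong (a ^_) (ℕ.*-comm (suc s) (suc t)) ⟩
    a ^ (suc t ℕ.* suc s)      ≈⟨ ^-assocʳ a (suc t) (suc s) ⟨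
    (a * a ^ t) ^ suc s        ≈⟨ ^-congˡ (suc s) (trans (*-congˡ aᵗ≈0) (zeroʳ a)) ⟩
    0# * 0# ^ s                ≈⟨ zeroˡ _ ⟩
    0#                         ∎

  -- R / Ann(a), a copy of the ideal aR presented on the carrier of R (x ≈ y iff a x ≈ a y).
  annihilatorQuotient : Carrier → CommutativeRing c ℓ
  annihilatorQuotient a = record
    { _≈_ = _≈ₐ_ ; _+_ = _+_ ; _*_ = _*_ ; -_ = -_ ; 0# = 0# ; 1# = 1#
    ; isCommutativeRing = record
      { isRing = record
        { +-isAbelianGroup = record
          { isGroup = record
            { isMonoid = record
              { isSemigroup = record
                { isMagma = record { isEquivalence = On.isEquivalence (a *_) isEquivalence ; ∙-cong = +-congₐ }
                ; assoc = λ x y z → lift (+-assoc x y z) }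
              ; identity = lift ∘ +-identityˡ , lift ∘ +-identityʳ }
            ; inverse = lift ∘ -‿inverseˡ , lift ∘ -‿inverseʳ
            ; ⁻¹-cong = -‿congₐ }
          ; comm = λ x y → lift (+-comm x y) }
        ; *-cong = *-congₐ
        ; *-assoc = λ x y z → lift (*-assoc x y z)
        ; *-identity = lift ∘ *-identityˡ , lift ∘ *-identityʳ
        ; distrib = (λ x y z → lift (distribˡ x y z)) , (λ x y z → lift (distribʳ x y z)) }
      ; *-comm = λ x y → lift (*-comm x y) } }
    where
    infix 4 _≈ₐ_
    _≈ₐ_ : Carrier → Carrier → Set ℓ
    x ≈ₐ y = a * x ≈ a * y
    lift : ∀ {x y} → x ≈ y → x ≈ₐ y
    lift = *-congˡ
    +-congₐ : ∀ {x y u v} → x ≈ₐ y → u ≈ₐ v → x + u ≈ₐ y + v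
    +-congₐ {x} {y} {u} {v} x≈y u≈v = begin
      a * (x + u)    ≈⟨ distribˡ a x u ⟩
      a * x + a * u  ≈⟨ +-cong x≈y u≈v ⟩
      a * y + a * v  ≈⟨ distribˡ a y v ⟨
      a * (y + v)    ∎
    -‿congₐ : ∀ {x y} → x ≈ₐ y → - x ≈ₐ - y
    -‿congₐ {x} {y} x≈y = begin
      a * - x    ≈⟨ -‿distribʳ-* a x ⟨
      - (a * x)  ≈⟨ -‿cong x≈y ⟩
      - (a * y)  ≈⟨ -‿distribʳ-* a y ⟩
      a * - y    ∎
    *-congₐ : ∀ {x y u v} → x ≈ₐ y → u ≈ₐ v → x * u ≈ₐ y * v
    *-congₐ {x} {y} {u} {v} x≈y u≈v = begin
      a * (x * u)    ≈⟨ *-assoc a x u ⟨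
      a * x * u      ≈⟨ *-congʳ x≈y ⟩
      a * y * u      ≈⟨ xy∙z≈xz∙y a y u ⟩
      a * u * y      ≈⟨ *-congʳ u≈v ⟩
      a * v * y      ≈⟨ xy∙z≈xz∙y a v y ⟩
      a * y * v      ≈⟨ *-assoc a y v ⟩
      a * (y * v)    ∎

  annihilatorQuotient-isIntegralDomain :
    ∀ {e} → IsIdempotent e → e ≉ 0# →
    (∀ x y → (e * x) * (e * y) ≈ 0# → e * x ≈ 0# ⊎ e * y ≈ 0#) →
    IsIntegralDomain (annihilatorQuotient e)
  annihilatorQuotient-isIntegralDomain {e} e-idem e≉0 no-zero-divisors =
    (λ e≈0 → e≉0 (trans (sym (*-identityʳ e)) (trans e≈0 (zeroʳ e)))) ,
    λ x y exy≈0 → Sum.map (flip trans (sym (zeroʳ e))) (flip trans (sym (zeroʳ e)))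
      (no-zero-divisors x y (begin
        e * x * (e * y)  ≈⟨ interchange e x e y ⟩
        e * e * (x * y)  ≈⟨ *-congʳ e-idem ⟩
        e * (x * y)      ≈⟨ exy≈0 ⟩
        e * 0#           ≈⟨ zeroʳ e ⟩
        0#               ∎))

  -- For primitive e the ring eR is local with maximal ideal its nilpotents, so w lies in its socle.
  IsNilAnnihilator : Carrier → Pred Carrier (c ⊔ ℓ)
  IsNilAnnihilator e w = w ≉ 0# × w * e ≈ w × (∀ {y} → y * e ≈ y → Nilpotent y → w * y ≈ 0#)

  nilAnnihilator-kills : ∀ {p v w} → IsIdempotent p → Nilpotent (p * v) → IsNilAnnihilator p w → v * w ≈ 0#
  nilAnnihilator-kills {p} {v} {w} p-idem pv-nil (_ , w∈pR , kills) = begin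
    v * w        ≈⟨ *-congˡ w∈pR ⟨
    v * (w * p)  ≈⟨ x∙yz≈y∙zx v w p ⟩
    w * (p * v)  ≈⟨ kills (multiple-below p-idem v) pv-nil ⟩
    0#           ∎

module FiniteRing {c ℓ n} (R : CommutativeRing c ℓ)
                  (enum : Inverse (≡.setoid (Fin n)) (CommutativeRing.setoid R)) where
  open CommutativeRing R
  open IdempotentTheory R
  open FiniteSetoid setoid enum public
  open Inverse enum using (from)
  open import Algebra.Properties.Ring ring using (-0#≈0#; [y-z]x≈yx-zx)
  open import Algebra.Properties.CommutativeSemigroup *-commutativeSemigroup
    using (interchange; xy∙z≈xz∙y)
  open import Relation.Binary.Reasoning.Setoid setoid

  idempotent-power : ∀ a → ∃ λ s → IsIdempotent (a ^ suc s)
  idempotent-power a with Fin.pigeonhole (ℕ.n<1+n n) (λ i → from (a ^ suc (toℕ i)))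
  ... | i , j , i<j , same with ℕ.m≤n⇒∃[o]m+o≡n i<j
  ...   | o , i+o≡j = toℕ i ℕ.+ o ℕ.* suc (toℕ i) , periodic⇒idempotent a (toℕ i) o (begin
    a ^ suc (toℕ i)             ≈⟨ from-injective same ⟩
    a ^ suc (toℕ j)             ≡⟨ ≡.cong (λ k → a ^ suc k) i+o≡j ⟨
    a ^ suc (suc (toℕ i) ℕ.+ o) ≡⟨ ≡.cong (a ^_) (ℕ.+-suc (suc (toℕ i)) o) ⟨
    a ^ (suc (toℕ i) ℕ.+ suc o) ∎)

  nilpotent? : Decidable Nilpotent
  nilpotent? a with idempotent-power a
  ... | s , idem = map′ (λ aˢ≈0 → suc s , aˢ≈0) (idempotent-power-vanishes s idem) (a ^ suc s ≟ 0#)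

  properSummand-resp : ∀ f → IsProperSummand f Respects _≈_
  properSummand-resp f g≈h (g-idem , g≤f , g≉0 , g≉f) =
    trans (*-cong (sym g≈h) (sym g≈h)) (trans g-idem g≈h) ,
    trans (*-congʳ (sym g≈h)) (trans g≤f g≈h) ,
    (λ h≈0 → g≉0 (trans g≈h h≈0)) ,
    (λ h≈f → g≉f (trans g≈h h≈f))

  properSummand? : ∀ f → Decidable (IsProperSummand f)
  properSummand? f g = (g * g ≟ g) ×-dec (g * f ≟ g) ×-dec ¬? (g ≟ 0#) ×-dec ¬? (g ≟ f)

  no-proper-summand⇒primitive : ∀ {e} → IsIdempotent e → e ≉ 0# → ¬ ∃ (IsProperSummand e) → IsPrimitive e
  no-proper-summand⇒primitive {e} e-idem e≉0 none = record
    { idempotent = e-idem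
    ; nonzero    = e≉0
    ; minimal    = minimal
    }
    where
    minimal : ∀ {g} → IsIdempotent g → g * e ≈ g → g ≈ 0# ⊎ g ≈ e
    minimal {g} g-idem g≤e with g ≟ 0# | g ≟ e
    ... | yes g≈0 | _       = inj₁ g≈0
    ... | no _    | yes g≈e = inj₂ g≈e
    ... | no g≉0  | no g≉e  = contradiction (g , g-idem , g≤e , g≉0 , g≉e) none

  isPrimitive? : Decidable IsPrimitive
  isPrimitive? e =
    map′ (λ (e-idem , e≉0 , none) → no-proper-summand⇒primitive e-idem e≉0 none)
         (λ e-prim → IsPrimitive.idempotent e-prim , IsPrimitive.nonzero e-prim ,
                     primitive⇒no-proper-summand e-prim)
         ((e * e ≟ e) ×-dec ¬? (e ≟ 0#) ×-dec ¬? (any? (properSummand-resp e) (properSummand? e)))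

  fixed-resp : ∀ a → (λ z → a * z ≈ z) Respects _≈_
  fixed-resp a x≈y az≈z = trans (*-congˡ (sym x≈y)) (trans az≈z x≈y)

  fixes? : ∀ f → Decidable (λ z → f * z ≈ z)
  fixes? f z = f * z ≟ z

  Fix : Carrier → Subset n
  Fix f = ⟦ fixes? f ⟧

  summand-Fix⊂ : ∀ {f g} → IsIdempotent f → IsProperSummand f g → Fix g ⊂ Fix f
  summand-Fix⊂ {f} {g} f-idem (g-idem , g≤f , _ , g≉f) =
    ⟦⟧-⊂ (fixes? g) (fixes? f) (fixed-resp g) (fixed-resp f) g-fixed⇒f-fixed f-idem (λ gf≈f → g≉f (trans (sym g≤f) gf≈f))
    where
    g-fixed⇒f-fixed : ∀ {z} → g * z ≈ z → f * z ≈ z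
    g-fixed⇒f-fixed {z} gz≈z = begin
      f * z        ≈⟨ *-congˡ gz≈z ⟨
      f * (g * z)  ≈⟨ *-assoc f g z ⟨
      f * g * z    ≈⟨ *-congʳ (trans (*-comm f g) g≤f) ⟩
      g * z        ≈⟨ gz≈z ⟩
      z            ∎

  -- Splitting f = g + (f - g) shrinks Fix, and one of the two parts still does not kill y.
  primitive-component : ∀ {y} → y ≉ 0# → ∃ λ e → IsPrimitive e × e * y ≉ 0#
  primitive-component {y} y≉0 =
    descend 1# (On.wellFounded Fix ⊂-wellFounded 1#) (*-identityˡ 1#) (λ 1y≈0 → y≉0 (trans (sym (*-identityˡ y)) 1y≈0))
    where
    descend : ∀ f → Acc (_⊂_ on Fix) f → IsIdempotent f → f * y ≉ 0# → ∃ λ e → IsPrimitive e × e * y ≉ 0#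
    descend f (acc smaller) f-idem fy≉0 with any? (properSummand-resp f) (properSummand? f)
    ... | no none = f , no-proper-summand⇒primitive f-idem f≉0 none , fy≉0
      where f≉0 = λ f≈0 → fy≉0 (trans (*-congʳ f≈0) (zeroˡ y))
    ... | yes (g , g-summand@(g-idem , g≤f , _)) with g * y ≟ 0#
    ...   | no gy≉0 = descend g (smaller (summand-Fix⊂ f-idem g-summand)) g-idem gy≉0
    ...   | yes gy≈0 = descend (f - g) (smaller (summand-Fix⊂ f-idem f-g-summand)) (proj₁ f-g-summand) f-g-y≉0
      where
      f-g-summand = complementary-summand f-idem g≤f g-summand
      f-g-y≉0 : (f - g) * y ≉ 0#
      f-g-y≉0 f-g-y≈0 = fy≉0 (begin
        f * y           ≈⟨ +-identityʳ (f * y) ⟨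
        f * y + 0#      ≈⟨ +-congˡ (trans (-‿cong gy≈0) -0#≈0#) ⟨
        f * y - g * y   ≈⟨ [y-z]x≈yx-zx y f g ⟨
        (f - g) * y     ≈⟨ f-g-y≈0 ⟩
        0#              ∎)

  nilpotent-component : ∀ {v y} → v * y ≈ 0# → y ≉ 0# → ∃ λ p → IsPrimitive p × Nilpotent (p * v)
  nilpotent-component {v} {y} vy≈0 y≉0 with primitive-component y≉0
  ... | p , p-prim , py≉0 with idempotent-power (p * v)
  ...   | s , b-idem with IsPrimitive.minimal p-prim b-idem (power-below (IsPrimitive.idempotent p-prim) v s)
  ...     | inj₁ b≈0 = p , p-prim , suc s , b≈0
  ...     | inj₂ b≈p = contradiction (begin
    p * y                      ≈⟨ *-congʳ b≈p ⟨
    p * v * (p * v) ^ s * y    ≈⟨ *-assoc (p * v) _ y ⟩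
    p * v * ((p * v) ^ s * y)  ≈⟨ interchange p v _ y ⟩
    p * (p * v) ^ s * (v * y)  ≈⟨ *-congˡ vy≈0 ⟩
    p * (p * v) ^ s * 0#       ≈⟨ zeroʳ _ ⟩
    0#                         ∎) py≉0

  nonannihilated-resp : ∀ a → (λ z → a * z ≉ 0#) Respects _≈_
  nonannihilated-resp a x≈y ax≉0 ay≈0 = ax≉0 (trans (*-congˡ x≈y) ay≈0)

  nonannihilated? : ∀ a → Decidable (λ z → a * z ≉ 0#)
  nonannihilated? a z = ¬? (a * z ≟ 0#)

  Support : Carrier → Subset n
  Support w = ⟦ nonannihilated? w ⟧

  -- If w does not kill some nilpotent y ∈ eR, multiplying w by the last power of y that it
  -- does not kill shrinks its support.
  nilAnnihilator-exists : ∀ {e w} → w ≉ 0# → w * e ≈ w → ∃ (IsNilAnnihilator e)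
  nilAnnihilator-exists {e} {w} = descend w (On.wellFounded Support ⊂-wellFounded w)
    where
    Witness : Carrier → Carrier → Set ℓ
    Witness w y = y * e ≈ y × Nilpotent y × w * y ≉ 0#

    witness-resp : ∀ w → Witness w Respects _≈_
    witness-resp w y≈y′ (y∈eR , y-nil , wy≉0) =
      trans (*-congʳ (sym y≈y′)) (trans y∈eR y≈y′) , nilpotent-resp y≈y′ y-nil ,
      nonannihilated-resp w y≈y′ wy≉0

    descend : ∀ w → Acc (_⊂_ on Support) w → w ≉ 0# → w * e ≈ w → ∃ (IsNilAnnihilator e)
    descend w (acc smaller) w≉0 w∈eR
      with any? (witness-resp w) (λ y → (y * e ≟ y) ×-dec nilpotent? y ×-dec nonannihilated? w y)
    ... | no none = w , w≉0 , w∈eR , λ {y} y∈eR y-nil →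
      decidable-stable (w * y ≟ 0#) (λ wy≉0 → none (y , y∈eR , y-nil , wy≉0))
    ... | yes (y , _ , (t , yᵗ≈0) , wy≉0)
      with transition (λ j → w * y ^ suc j ≟ 0#) (λ wy1≈0 → wy≉0 (trans (*-congˡ (sym (*-identityʳ y))) wy1≈0)) {t}
                      (trans (*-congˡ (trans (*-congˡ yᵗ≈0) (zeroʳ y))) (zeroʳ w))
    ...   | j , wyʲ⁺¹≉0 , wyʲ⁺²≈0 =
      descend (w * y ^ suc j) (smaller support⊂) wyʲ⁺¹≉0 (trans (xy∙z≈xz∙y w _ e) (*-congʳ w∈eR))
      where
      support⊂ : Support (w * y ^ suc j) ⊂ Support w
      support⊂ = ⟦⟧-⊂ (nonannihilated? _) (nonannihilated? w) (nonannihilated-resp _) (nonannihilated-resp w)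
        (λ {z} w′z≉0 wz≈0 → w′z≉0 (trans (xy∙z≈xz∙y w _ z) (trans (*-congʳ wz≈0) (zeroˡ _))))
        wy≉0
        (λ w′y≉0 → w′y≉0 (trans (*-assoc w _ y) (trans (*-congˡ (*-comm _ y)) wyʲ⁺²≈0)))

module Domination {c ℓ} (R : CommutativeRing c ℓ) where
  open CommutativeRing R hiding (zero)
  open ZeroDivisorGraph R

  annihilates⇒vertex : ∀ {x y} → x ≉ 0# → y ≉ 0# → x * y ≈ 0# → IsVertex x
  annihilates⇒vertex x≉0 y≉0 xy≈0 = (_ , y≉0 , xy≈0) , x≉0

  Adj⇒*≈0 : ∀ {v a} → Adj v a → v * a ≈ 0#
  Adj⇒*≈0 (inj₁ (_ , va≈0))   = va≈0
  Adj⇒*≈0 (inj₂ (v≈a , vv≈0)) = trans (*-congˡ (sym v≈a)) vv≈0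

  total⇒dominating : ∀ {k} (X : VertexSet k) → IsTotalDominating X → IsDominating X
  total⇒dominating X X-total v v-vertex _ = X-total v v-vertex

  TotalDominationBounded : Set (c ⊔ ℓ)
  TotalDominationBounded =
    ∀ {k} (X : VertexSet k) → IsDominating X → ∃ λ m → m ≤ k × Σ (VertexSet m) IsTotalDominating

  domination⇔totalDomination : TotalDominationBounded → ∀ k →
    (IsDominationNumber k → IsTotalDominationNumber k) × (IsTotalDominationNumber k → IsDominationNumber k)
  domination⇔totalDomination bounded k = domination⇒total , total⇒domination
    where
    domination⇒total : IsDominationNumber k → IsTotalDominationNumber k
    domination⇒total ((X , X-dom) , X-min) with bounded X X-dom
    ... | m , m≤k , Y , Y-total with ℕ.m≤n⇒m<n∨m≡n m≤k
    ...   | inj₁ m<k    = contradiction (Y , total⇒dominating Y Y-total) (X-min m m<k)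
    ...   | inj₂ ≡.refl = (Y , Y-total) , λ m m<k (Z , Z-total) → X-min m m<k (Z , total⇒dominating Z Z-total)
    total⇒domination : IsTotalDominationNumber k → IsDominationNumber k
    total⇒domination ((Y , Y-total) , Y-min) = (Y , total⇒dominating Y Y-total) , λ m m<k (X , X-dom) →
      let m′ , m′≤m , Z = bounded X X-dom in Y-min m′ (ℕ.≤-<-trans m′≤m m<k) Z

  module _ (_≟_ : B.Decidable _≈_) where

    *≈0⇒Adj : ∀ {v a} → v * a ≈ 0# → Adj v a
    *≈0⇒Adj {v} {a} va≈0 with v ≟ a
    ... | yes v≈a = inj₂ (v≈a , trans (*-congˡ v≈a) va≈0)
    ... | no  v≉a = inj₁ (v≉a , va≈0)

    dominated : ∀ {k} (X : VertexSet k) → IsDominating X →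
                ∀ {v} → IsVertex v → ∃ λ i → v ≈ elt X i ⊎ v * elt X i ≈ 0#
    dominated X X-dom {v} v-vertex with Fin.any? (λ i → v ≟ elt X i)
    ... | yes (i , v≈xᵢ) = i , inj₁ v≈xᵢ
    ... | no v∉X = let i , v~xᵢ = X-dom v v-vertex v∉X in i , inj₂ (Adj⇒*≈0 v~xᵢ)

    lone-dominator-universal : (X : VertexSet 1) → IsDominating X → ∀ {g} → g ≈ elt X zero →
                               ∀ {v} → IsVertex v → v ≉ g → v * g ≈ 0#
    lone-dominator-universal X X-dom g≈x v-vertex v≉g with dominated X X-dom v-vertex
    ... | zero , inj₁ v≈x  = contradiction (trans v≈x (sym g≈x)) v≉g
    ... | zero , inj₂ vx≈0 = trans (*-congˡ g≈x) vx≈0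

    insert : ∀ {m} (Y : VertexSet m) {x} → IsVertex x → ¬ x ∈ˢ Y → VertexSet (suc m)
    insert Y {x} x-vertex x∉Y = record { elt = elt′ ; vertex = vertex′ ; distinct = distinct′ }
      where
      elt′ : Fin (suc _) → Carrier
      elt′ zero    = x
      elt′ (suc i) = elt Y i
      vertex′ : ∀ i → IsVertex (elt′ i)
      vertex′ zero    = x-vertex
      vertex′ (suc i) = VertexSet.vertex Y i
      distinct′ : ∀ i j → elt′ i ≈ elt′ j → i ≡ j
      distinct′ zero    zero    _   = ≡.refl
      distinct′ zero    (suc j) x≈y = contradiction (j , x≈y) x∉Y
      distinct′ (suc i) zero    y≈x = contradiction (i , sym y≈x) x∉Y
      distinct′ (suc i) (suc j) y≈y = ≡.cong suc (distinct Y i j y≈y)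

    distinct-cover : ∀ {k} (h : Fin k → Carrier) → (∀ j → IsVertex (h j)) →
                     ∃ λ m → m ≤ k × Σ (VertexSet m) λ Y → ∀ j → h j ∈ˢ Y
    distinct-cover {zero} h _ =
      0 , z≤n , record { elt = λ () ; vertex = λ () ; distinct = λ () } , λ ()
    distinct-cover {suc k} h h-vertex
      with distinct-cover (λ j → h (suc j)) (λ j → h-vertex (suc j))
    ... | m , m≤k , Y , covered with Fin.any? (λ i → h zero ≟ elt Y i)
    ...   | yes h₀∈Y = m , ℕ.m≤n⇒m≤1+n m≤k , Y , λ { zero → h₀∈Y ; (suc j) → covered j }
    ...   | no  h₀∉Y = suc m , s≤s m≤k , insert Y (h-vertex zero) h₀∉Y , λ
      { zero    → zero , refl
      ; (suc j) → let i , hⱼ≈yᵢ = covered j in suc i , hⱼ≈yᵢ }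

    annihilating-family⇒totalDominating :
      ∀ {k} (h : Fin k → Carrier) → (∀ j → IsVertex (h j)) →
      (∀ {v} → IsVertex v → ∃ λ j → v * h j ≈ 0#) →
      ∃ λ m → m ≤ k × Σ (VertexSet m) IsTotalDominating
    annihilating-family⇒totalDominating h h-vertex annihilated =
      let m , m≤k , Y , covered = distinct-cover h h-vertex in
      m , m≤k , Y , λ v v-vertex →
        let j , vhⱼ≈0 = annihilated v-vertex
            i , hⱼ≈yᵢ = covered j
        in i , *≈0⇒Adj (trans (*-congˡ (sym hⱼ≈yᵢ)) vhⱼ≈0)

module ℤ₂Splitting {c ℓ} (R : CommutativeRing c ℓ) (_≟_ : B.Decidable (CommutativeRing._≈_ R)) where
  open CommutativeRing R
  open IdempotentTheory R
  open ZeroDivisorGraph R using (IsVertex)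
  open Domination R using (annihilates⇒vertex)
  open import Algebra.Properties.Ring ring using (-0#≈0#; -‿distribʳ-*; x+x≈x⇒x≈0; +-inverseʳ-unique; x∙y⁻¹≈ε⇒x≈y)
  open import Algebra.Properties.CommutativeSemigroup *-commutativeSemigroup using (interchange; xy∙z≈xz∙y)
  open import Relation.Binary.Reasoning.Setoid setoid

  -- fR = {0, f} is a copy of ℤ₂ and R ≅ fR × R / Ann(1 - f).
  module _ {f} (f-idem : IsIdempotent f) (f≉0 : f ≉ 0#) (two-valued : ∀ r → f * r ≈ 0# ⊎ f * r ≈ f) where

    private
      e = 1# - f

    fromBool : Bool → Carrier
    fromBool true  = f
    fromBool false = 0#

    toBool : Carrier → Bool
    toBool r = does ((f * r) ≟ f)

    f*≈fromBool∘toBool : ∀ r → f * r ≈ fromBool (toBool r)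
    f*≈fromBool∘toBool r with (f * r) ≟ f | two-valued r
    ... | yes fr≈f | _         = fr≈f
    ... | no  _    | inj₁ fr≈0 = fr≈0
    ... | no  fr≉f | inj₂ fr≈f = contradiction fr≈f fr≉f

    fromBool-injective : ∀ {a b} → fromBool a ≈ fromBool b → a ≡ b
    fromBool-injective {true}  {true}  _    = ≡.refl
    fromBool-injective {true}  {false} f≈0  = contradiction f≈0 f≉0
    fromBool-injective {false} {true}  0≈f  = contradiction (sym 0≈f) f≉0
    fromBool-injective {false} {false} _    = ≡.refl

    f+f≈0 : f + f ≈ 0#
    f+f≈0 = [ trans (sym f*2≈f+f) , (λ f*2≈f → contradiction (x+x≈x⇒x≈0 f (trans (sym f*2≈f+f) f*2≈f)) f≉0) ]′
              (two-valued (1# + 1#))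
      where
      f*2≈f+f : f * (1# + 1#) ≈ f + f
      f*2≈f+f = trans (distribˡ f 1# 1#) (+-cong (*-identityʳ f) (*-identityʳ f))

    fromBool-xor : ∀ a b → fromBool (a xor b) ≈ fromBool a + fromBool b
    fromBool-xor true  true  = sym f+f≈0
    fromBool-xor true  false = sym (+-identityʳ f)
    fromBool-xor false b     = sym (+-identityˡ (fromBool b))

    fromBool-∧ : ∀ a b → fromBool (a ∧ b) ≈ fromBool a * fromBool b
    fromBool-∧ true  true  = sym f-idem
    fromBool-∧ true  false = sym (zeroʳ f)
    fromBool-∧ false b     = sym (zeroˡ (fromBool b))

    fromBool≈-fromBool : ∀ a → fromBool a ≈ - fromBool a
    fromBool≈-fromBool true  = +-inverseʳ-unique f f f+f≈0
    fromBool≈-fromBool false = sym -0#≈0#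

    f*fromBool : ∀ a → f * fromBool a ≈ fromBool a
    f*fromBool true  = f-idem
    f*fromBool false = zeroʳ f

    toBool-cong : ∀ {x y} → x ≈ y → toBool x ≡ toBool y
    toBool-cong {x} {y} x≈y = fromBool-injective (begin
      fromBool (toBool x)  ≈⟨ f*≈fromBool∘toBool x ⟨
      f * x                ≈⟨ *-congˡ x≈y ⟩
      f * y                ≈⟨ f*≈fromBool∘toBool y ⟩
      fromBool (toBool y)  ∎)

    toBool-+ : ∀ x y → toBool (x + y) ≡ toBool x xor toBool y
    toBool-+ x y = fromBool-injective (begin
      fromBool (toBool (x + y))                   ≈⟨ f*≈fromBool∘toBool (x + y) ⟨
      f * (x + y)                                 ≈⟨ distribˡ f x y ⟩
      f * x + f * y                               ≈⟨ +-cong (f*≈fromBool∘toBool x) (f*≈fromBool∘toBool y) ⟩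
      fromBool (toBool x) + fromBool (toBool y)   ≈⟨ fromBool-xor (toBool x) (toBool y) ⟨
      fromBool (toBool x xor toBool y)            ∎)

    toBool-* : ∀ x y → toBool (x * y) ≡ toBool x ∧ toBool y
    toBool-* x y = fromBool-injective (begin
      fromBool (toBool (x * y))                   ≈⟨ f*≈fromBool∘toBool (x * y) ⟨
      f * (x * y)                                 ≈⟨ *-congʳ f-idem ⟨
      f * f * (x * y)                             ≈⟨ interchange f f x y ⟩
      f * x * (f * y)                             ≈⟨ *-cong (f*≈fromBool∘toBool x) (f*≈fromBool∘toBool y) ⟩
      fromBool (toBool x) * fromBool (toBool y)   ≈⟨ fromBool-∧ (toBool x) (toBool y) ⟨
      fromBool (toBool x ∧ toBool y)              ∎)

    toBool-neg : ∀ x → toBool (- x) ≡ toBool x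
    toBool-neg x = fromBool-injective (begin
      fromBool (toBool (- x))   ≈⟨ f*≈fromBool∘toBool (- x) ⟨
      f * - x                   ≈⟨ -‿distribʳ-* f x ⟨
      - (f * x)                 ≈⟨ -‿cong (f*≈fromBool∘toBool x) ⟩
      - fromBool (toBool x)     ≈⟨ fromBool≈-fromBool (toBool x) ⟨
      fromBool (toBool x)       ∎)

    toBool-1 : toBool 1# ≡ true
    toBool-1 = fromBool-injective (trans (sym (f*≈fromBool∘toBool 1#)) (*-identityʳ f))

    toBool-0 : toBool 0# ≡ false
    toBool-0 = fromBool-injective (trans (sym (f*≈fromBool∘toBool 0#)) (zeroʳ f))

    ≅ℤ₂×annihilatorQuotient : R ≅ʳ ℤ₂× (annihilatorQuotient e)
    ≅ℤ₂×annihilatorQuotient = φ , record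
      { isRingMonomorphism = record
        { isRingHomomorphism = record
          { isSemiringHomomorphism = record
            { isNearSemiringHomomorphism = record
              { +-isMonoidHomomorphism = record
                { isMagmaHomomorphism = record
                  { isRelHomomorphism = record { cong = λ x≈y → toBool-cong x≈y , *-congˡ x≈y }
                  ; homo = λ x y → toBool-+ x y , refl }
                ; ε-homo = toBool-0 , refl }
              ; *-homo = λ x y → toBool-* x y , refl }
            ; 1#-homo = toBool-1 , refl }
          ; -‿homo = λ x → toBool-neg x , refl }
        ; injective = injective }
      ; surjective = λ bd → let z , φz≈bd = strictlySurjective bd in
          z , λ w≈z → ≡.trans (toBool-cong w≈z) (proj₁ φz≈bd) , trans (*-congˡ w≈z) (proj₂ φz≈bd) }
      where
      φ : Carrier → Bool × Carrier
      φ r = toBool r , r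
      injective : ∀ {x y} → toBool x ≡ toBool y × e * x ≈ e * y → x ≈ y
      injective {x} {y} (same-bool , ex≈ey) = begin
        x                              ≈⟨ complement-split f x ⟨
        f * x + e * x                  ≈⟨ +-cong (f*≈fromBool∘toBool x) ex≈ey ⟩
        fromBool (toBool x) + e * y    ≡⟨ ≡.cong (λ b → fromBool b + e * y) same-bool ⟩
        fromBool (toBool y) + e * y    ≈⟨ +-congʳ (f*≈fromBool∘toBool y) ⟨
        f * y + e * y                  ≈⟨ complement-split f y ⟩
        y                              ∎
      strictlySurjective : ∀ bd → ∃ λ z → toBool z ≡ proj₁ bd × e * z ≈ e * proj₂ bd
      strictlySurjective (b , d) = fromBool b + e * d , fromBool-injective (begin
          fromBool (toBool z)            ≈⟨ f*≈fromBool∘toBool z ⟨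
          f * z                          ≈⟨ distribˡ f _ _ ⟩
          f * fromBool b + f * (e * d)   ≈⟨ +-cong (f*fromBool b) (trans (sym (*-assoc f e d)) (trans (*-congʳ fe≈0) (zeroˡ d))) ⟩
          fromBool b + 0#                ≈⟨ +-identityʳ _ ⟩
          fromBool b                     ∎) , (begin
          e * z                          ≈⟨ distribˡ e _ _ ⟩
          e * fromBool b + e * (e * d)   ≈⟨ +-cong (e*fromBool b) (trans (sym (*-assoc e e d)) (*-congʳ e-idem)) ⟩
          0# + e * d                     ≈⟨ +-identityˡ _ ⟩
          e * d                          ∎)
        where
        z = fromBool b + e * d
        e-idem : IsIdempotent e
        e-idem = complement-idempotent f-idem
        fe≈0 : f * e ≈ 0#
        fe≈0 = trans (*-comm f e) (complement-orthogonal f-idem)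
        e*fromBool : ∀ a → e * fromBool a ≈ 0#
        e*fromBool true  = complement-orthogonal f-idem
        e*fromBool false = zeroʳ e

  universal-idempotent⇒ℤ₂×domain :
    ∀ {f} → IsIdempotent f → f ≉ 0# → f ≉ 1# → (∀ {v} → IsVertex v → v ≉ f → v * f ≈ 0#) →
    ∃ λ D → IsIntegralDomain D × R ≅ʳ ℤ₂× D
  universal-idempotent⇒ℤ₂×domain {f} f-idem f≉0 f≉1 universal =
    annihilatorQuotient e ,
    annihilatorQuotient-isIntegralDomain e-idem e≉0 no-zero-divisors ,
    ≅ℤ₂×annihilatorQuotient f-idem f≉0 two-valued
    where
    e = 1# - f
    e≉0 : e ≉ 0#
    e≉0 e≈0 = f≉1 (sym (x∙y⁻¹≈ε⇒x≈y 1# f e≈0))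
    e-idem : IsIdempotent e
    e-idem = complement-idempotent f-idem
    ef≈0 : e * f ≈ 0#
    ef≈0 = complement-orthogonal f-idem
    fe≈0 : f * e ≈ 0#
    fe≈0 = trans (*-comm f e) ef≈0

    two-valued : ∀ r → f * r ≈ 0# ⊎ f * r ≈ f
    two-valued r with (f * r) ≟ 0# | (f * r) ≟ f
    ... | yes fr≈0 | _        = inj₁ fr≈0
    ... | no _     | yes fr≈f = inj₂ fr≈f
    ... | no fr≉0  | no fr≉f  = contradiction (begin
      f * r      ≈⟨ multiple-below f-idem r ⟨
      f * r * f  ≈⟨ universal (annihilates⇒vertex fr≉0 e≉0 fr·e≈0) fr≉f ⟩
      0#         ∎) fr≉0
      where
      fr·e≈0 : f * r * e ≈ 0#
      fr·e≈0 = trans (xy∙z≈xz∙y f r e) (trans (*-congʳ fe≈0) (zeroˡ r))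

    no-zero-divisors : ∀ x y → e * x * (e * y) ≈ 0# → e * x ≈ 0# ⊎ e * y ≈ 0#
    no-zero-divisors x y exey≈0 with (e * x) ≟ 0# | (e * y) ≟ 0#
    ... | yes ex≈0 | _        = inj₁ ex≈0
    ... | no _     | yes ey≈0 = inj₂ ey≈0
    ... | no ex≉0  | no ey≉0  = contradiction (universal v-vertex v≉f) vf≉0
      where
      v = e * x + f
      vf≈f : v * f ≈ f
      vf≈f = begin
        (e * x + f) * f    ≈⟨ distribʳ f (e * x) f ⟩
        e * x * f + f * f  ≈⟨ +-cong (trans (xy∙z≈xz∙y e x f) (trans (*-congʳ ef≈0) (zeroˡ x))) f-idem ⟩
        0# + f             ≈⟨ +-identityˡ f ⟩
        f                  ∎
      vf≉0 : v * f ≉ 0#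
      vf≉0 vf≈0 = f≉0 (trans (sym vf≈f) vf≈0)
      v·ey≈0 : v * (e * y) ≈ 0#
      v·ey≈0 = begin
        (e * x + f) * (e * y)          ≈⟨ distribʳ (e * y) (e * x) f ⟩
        e * x * (e * y) + f * (e * y)  ≈⟨ +-cong exey≈0 (trans (sym (*-assoc f e y)) (trans (*-congʳ fe≈0) (zeroˡ y))) ⟩
        0# + 0#                        ≈⟨ +-identityˡ 0# ⟩
        0#                             ∎
      v-vertex : IsVertex v
      v-vertex = annihilates⇒vertex (λ v≈0 → vf≉0 (trans (*-congʳ v≈0) (zeroˡ f))) ey≉0 v·ey≈0
      v≉f : v ≉ f
      v≉f v≈f = ex≉0 (begin
        e * x                ≈⟨ *-congʳ e-idem ⟨
        e * e * x            ≈⟨ *-assoc e e x ⟩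
        e * (e * x)          ≈⟨ +-identityʳ _ ⟨
        e * (e * x) + 0#     ≈⟨ +-congˡ ef≈0 ⟨
        e * (e * x) + e * f  ≈⟨ distribˡ e (e * x) f ⟨
        e * v                ≈⟨ *-congˡ v≈f ⟩
        e * f                ≈⟨ ef≈0 ⟩
        0#                   ∎)

module FiniteZeroDivisorGraph {c ℓ n} (R : CommutativeRing c ℓ)
                              (enum : Inverse (≡.setoid (Fin n)) (CommutativeRing.setoid R)) where
  open CommutativeRing R hiding (zero)
  open IdempotentTheory R
  open FiniteRing R enum
  open ZeroDivisorGraph R
  open Domination R
  open ℤ₂Splitting R _≟_
  open import Relation.Binary.Reasoning.Setoid setoid

  nilAnnihilatorOf : ∀ {e} → IsPrimitive e → ∃ (IsNilAnnihilator e)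
  nilAnnihilatorOf e-prim = nilAnnihilator-exists E.nonzero E.idempotent
    where module E = IsPrimitive e-prim

  nilAnnihilator : ∀ {e} → IsPrimitive e → Carrier
  nilAnnihilator e-prim = proj₁ (nilAnnihilatorOf e-prim)

  isNilAnnihilator : ∀ {e} (e-prim : IsPrimitive e) → IsNilAnnihilator e (nilAnnihilator e-prim)
  isNilAnnihilator e-prim = proj₂ (nilAnnihilatorOf e-prim)

  killed-by-nilAnnihilator : ∀ {e p v} (e-prim : IsPrimitive e) → p ≈ e → Nilpotent (p * v) →
                             v * nilAnnihilator e-prim ≈ 0#
  killed-by-nilAnnihilator e-prim p≈e pv-nil =
    nilAnnihilator-kills (IsPrimitive.idempotent e-prim) (nilpotent-resp (*-congʳ p≈e) pv-nil) (isNilAnnihilator e-prim)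

  vertex-component : ∀ {v} → IsVertex v → ∃ λ p → IsPrimitive p × Nilpotent (p * v)
  vertex-component ((y , y≉0 , vy≈0) , _) = nilpotent-component vy≈0 y≉0

  complement-vertex : ∀ {e} → IsPrimitive e → e ≉ 1# → IsVertex (1# - e)
  complement-vertex e-prim e≉1 =
    annihilates⇒vertex (λ 1-e≈0 → e≉1 (sym (x-y≈0⇒x≈y 1-e≈0))) (IsPrimitive.nonzero e-prim)
                       (complement-orthogonal (IsPrimitive.idempotent e-prim))

  nilAnnihilator-isVertex : ∀ {e w z} → IsPrimitive e → IsNilAnnihilator e w → IsVertex z → IsVertex w
  nilAnnihilator-isVertex {e} {w} {z} e-prim w-ann@(w≉0 , w∈eR , _) z-vertex with e ≟ 1#
  ... | no e≉1 = annihilates⇒vertex w≉0 (proj₂ (complement-vertex e-prim e≉1)) (begin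
    w * (1# - e)        ≈⟨ *-congʳ w∈eR ⟨
    w * e * (1# - e)    ≈⟨ *-assoc w e _ ⟩
    w * (e * (1# - e))  ≈⟨ *-congˡ (trans (*-comm e _) (complement-orthogonal (IsPrimitive.idempotent e-prim))) ⟩
    w * 0#              ≈⟨ zeroʳ w ⟩
    0#                  ∎)
  ... | yes e≈1 = annihilates⇒vertex w≉0 (proj₂ z-vertex)
    (trans (*-comm w z) (nilAnnihilator-kills (IsPrimitive.idempotent e-prim) ez-nil w-ann))
    where
    ez-nil : Nilpotent (e * z)
    ez-nil = let p , p-prim , pz-nil = vertex-component z-vertex in
      nilpotent-resp (*-congʳ (primitive-below-primitive p-prim e-prim (trans (*-congˡ e≈1) (*-identityʳ p)))) pz-nil

  -- The two ways a dominator of the vertex 1 - e can be related to e: it is 1 - e, or it lies in eR.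
  IsAttached : Carrier → Carrier → Set (c ⊔ ℓ)
  IsAttached x e = IsPrimitive e × (x ≈ 1# - e ⊎ x * e ≈ x)

  attached-resp : ∀ x → IsAttached x Respects _≈_
  attached-resp x e≈e′ (e-prim , inj₁ x≈1-e) = isPrimitive-resp e≈e′ e-prim , inj₁ (trans x≈1-e (+-congˡ (-‿cong e≈e′)))
  attached-resp x e≈e′ (e-prim , inj₂ x≤e)   = isPrimitive-resp e≈e′ e-prim , inj₂ (trans (*-congˡ (sym e≈e′)) x≤e)

  attached? : ∀ x → Decidable (IsAttached x)
  attached? x e = isPrimitive? e ×-dec ((x ≟ 1# - e) ⊎-dec (x * e ≟ x))

  IsPrimitivePair : Carrier → Set (c ⊔ ℓ)
  IsPrimitivePair e = IsPrimitive e × IsPrimitive (1# - e)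

  primitivePair-resp : IsPrimitivePair Respects _≈_
  primitivePair-resp e≈e′ (e-prim , 1-e-prim) =
    isPrimitive-resp e≈e′ e-prim , isPrimitive-resp (+-congˡ (-‿cong e≈e′)) 1-e-prim

  primitivePair? : Decidable IsPrimitivePair
  primitivePair? e = isPrimitive? e ×-dec isPrimitive? (1# - e)

  attached-unique : (∀ e → ¬ IsPrimitivePair e) → ∀ {z e p} → z ≉ 0# → IsAttached z e → IsAttached z p → e ≈ p
  attached-unique no-pair {z} {e} {p} z≉0 (e-prim , z~e) (p-prim , z~p) with e ≟ p
  ... | yes e≈p = e≈p
  ... | no  e≉p = ⊥-elim (cases z~e z~p)
    where
    pe≈0 : p * e ≈ 0#
    pe≈0 = trans (*-comm p e) (primitive-orthogonal e-prim p-prim e≉p)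
    complement-of-other : ∀ {a b} → a * b ≈ 0# → z ≈ 1# - a → z * b ≈ z → b ≈ 1# - a
    complement-of-other {a} {b} ab≈0 z≈1-a zb≈z = begin
      b             ≈⟨ complement-fixes ab≈0 ⟨
      (1# - a) * b  ≈⟨ *-congʳ z≈1-a ⟨
      z * b         ≈⟨ zb≈z ⟩
      z             ≈⟨ z≈1-a ⟩
      1# - a        ∎
    cases : z ≈ 1# - e ⊎ z * e ≈ z → z ≈ 1# - p ⊎ z * p ≈ z → ⊥
    cases (inj₁ z≈1-e) (inj₁ z≈1-p) = e≉p (complement-injective (trans (sym z≈1-e) z≈1-p))
    cases (inj₁ z≈1-e) (inj₂ zp≈z)  =
      no-pair e (e-prim , isPrimitive-resp (complement-of-other (trans (*-comm e p) pe≈0) z≈1-e zp≈z) p-prim)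
    cases (inj₂ ze≈z)  (inj₁ z≈1-p) =
      no-pair p (p-prim , isPrimitive-resp (complement-of-other pe≈0 z≈1-p ze≈z) e-prim)
    cases (inj₂ ze≈z)  (inj₂ zp≈z)  = z≉0 (begin
      z            ≈⟨ ze≈z ⟨
      z * e        ≈⟨ *-congʳ zp≈z ⟨
      z * p * e    ≈⟨ *-assoc z p e ⟩
      z * (p * e)  ≈⟨ *-congˡ pe≈0 ⟩
      z * 0#       ≈⟨ zeroʳ z ⟩
      0#           ∎)

  module WithoutPrimitivePair (no-pair : ∀ e → ¬ IsPrimitivePair e) {k} (X : VertexSet k) (X-dom : IsDominating X) where

    replacement : Fin k → Carrier
    replacement j with any? (attached-resp (elt X j)) (attached? (elt X j))
    ... | yes (_ , e-prim , _) = nilAnnihilator e-prim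
    ... | no  _                = elt X j

    replacement-vertex : ∀ j → IsVertex (replacement j)
    replacement-vertex j with any? (attached-resp (elt X j)) (attached? (elt X j))
    ... | yes (_ , e-prim , _) = nilAnnihilator-isVertex e-prim (isNilAnnihilator e-prim) (vertex X j)
    ... | no  _                = vertex X j

    attached-member : ∀ {v} → IsVertex v → ∀ {p} → IsPrimitive p → ∃ λ j → IsAttached (elt X j) p
    attached-member v-vertex {p} p-prim with p ≟ 1#
    ... | yes p≈1 = proj₁ (dominated _≟_ X X-dom v-vertex) , p-prim , inj₂ (trans (*-congˡ p≈1) (*-identityʳ _))
    ... | no  p≉1 with dominated _≟_ X X-dom (complement-vertex p-prim p≉1)
    ...   | j , inj₁ 1-p≈xⱼ    = j , p-prim , inj₁ (sym 1-p≈xⱼ)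
    ...   | j , inj₂ [1-p]xⱼ≈0 = j , p-prim , inj₂ (complement-kills⇒below [1-p]xⱼ≈0)

    replacement-annihilates : ∀ {v} → IsVertex v → ∃ λ j → v * replacement j ≈ 0#
    replacement-annihilates v-vertex =
      let p , p-prim , pv-nil = vertex-component v-vertex
          j , xⱼ~p = attached-member v-vertex p-prim
      in j , kills j xⱼ~p pv-nil
      where
      kills : ∀ {v p} j → IsAttached (elt X j) p → Nilpotent (p * v) → v * replacement j ≈ 0#
      kills j xⱼ~p pv-nil with any? (attached-resp (elt X j)) (attached? (elt X j))
      ... | yes (e , xⱼ~e@(e-prim , _)) =
        killed-by-nilAnnihilator e-prim (attached-unique no-pair (proj₂ (vertex X j)) xⱼ~p xⱼ~e) pv-nil
      ... | no  none = contradiction (_ , xⱼ~p) none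

    bounded : ∃ λ m → m ≤ k × Σ (VertexSet m) IsTotalDominating
    bounded = annihilating-family⇒totalDominating _≟_ replacement replacement-vertex replacement-annihilates

  module WithPrimitivePair (not-ℤ₂×D : ∀ (D : CommutativeRing c ℓ) → IsIntegralDomain D → ¬ (R ≅ʳ ℤ₂× D))
                           {e} (e-prim : IsPrimitive e) (f-prim : IsPrimitive (1# - e)) where
    private
      f = 1# - e
      module E = IsPrimitive e-prim
      module F = IsPrimitive f-prim

    fe≈0 : f * e ≈ 0#
    fe≈0 = complement-orthogonal E.idempotent

    e-vertex : IsVertex e
    e-vertex = annihilates⇒vertex E.nonzero F.nonzero (trans (*-comm e f) fe≈0)

    f-vertex : IsVertex f
    f-vertex = annihilates⇒vertex F.nonzero E.nonzero fe≈0

    e≉1 : e ≉ 1#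
    e≉1 e≈1 = F.nonzero (trans (+-congˡ (-‿cong e≈1)) (-‿inverseʳ 1#))

    f≉1 : f ≉ 1#
    f≉1 f≈1 = E.nonzero (x-y≈x⇒y≈0 f≈1)

    not-universal : ∀ {g} → IsIdempotent g → g ≉ 0# → g ≉ 1# → ¬ (∀ {v} → IsVertex v → v ≉ g → v * g ≈ 0#)
    not-universal g-idem g≉0 g≉1 universal =
      let D , D-domain , R≅ℤ₂×D = universal-idempotent⇒ℤ₂×domain g-idem g≉0 g≉1 universal
      in not-ℤ₂×D D D-domain R≅ℤ₂×D

    no-single-dominator : (X : VertexSet 1) → ¬ IsDominating X
    no-single-dominator X X-dom with dominated _≟_ X X-dom e-vertex | dominated _≟_ X X-dom f-vertex
    ... | zero , inj₁ e≈x  | _                = not-universal E.idempotent E.nonzero e≉1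
                                                   (lone-dominator-universal _≟_ X X-dom e≈x)
    ... | _                | zero , inj₁ f≈x  = not-universal F.idempotent F.nonzero f≉1
                                                   (lone-dominator-universal _≟_ X X-dom f≈x)
    ... | zero , inj₂ ex≈0 | zero , inj₂ fx≈0 = proj₂ (vertex X zero) (complement-split-zero ex≈0 fx≈0)

    pair : Fin 2 → Carrier
    pair zero       = nilAnnihilator e-prim
    pair (suc zero) = nilAnnihilator f-prim

    pair-vertex : ∀ j → IsVertex (pair j)
    pair-vertex zero       = nilAnnihilator-isVertex e-prim (isNilAnnihilator e-prim) e-vertex
    pair-vertex (suc zero) = nilAnnihilator-isVertex f-prim (isNilAnnihilator f-prim) f-vertex

    pair-annihilates : ∀ {v} → IsVertex v → ∃ λ j → v * pair j ≈ 0#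
    pair-annihilates v-vertex = let _ , p-prim , pv-nil = vertex-component v-vertex in by-component p-prim pv-nil
      where
      by-component : ∀ {p v} → IsPrimitive p → Nilpotent (p * v) → ∃ λ j → v * pair j ≈ 0#
      by-component {p} p-prim pv-nil with p ≟ e | p ≟ f
      ... | yes p≈e | _       = zero , killed-by-nilAnnihilator e-prim p≈e pv-nil
      ... | no _    | yes p≈f = suc zero , killed-by-nilAnnihilator f-prim p≈f pv-nil
      ... | no p≉e  | no p≉f  = contradiction
        (complement-split-zero (orthogonal e-prim p≉e) (orthogonal f-prim p≉f)) (IsPrimitive.nonzero p-prim)
        where
        orthogonal : ∀ {g} → IsPrimitive g → p ≉ g → g * p ≈ 0#
        orthogonal g-prim p≉g = trans (*-comm _ p) (primitive-orthogonal p-prim g-prim p≉g)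

    bounded : TotalDominationBounded
    bounded {0}           X X-dom = 0 , z≤n , X , λ v v-vertex → X-dom v v-vertex λ { (() , _) }
    bounded {1}           X X-dom = contradiction X-dom (no-single-dominator X)
    bounded {suc (suc k)} X X-dom =
      let m , m≤2 , Y = annihilating-family⇒totalDominating _≟_ pair pair-vertex pair-annihilates
      in m , ℕ.≤-trans m≤2 (s≤s (s≤s z≤n)) , Y

  totalDominationBounded : (∀ (D : CommutativeRing c ℓ) → IsIntegralDomain D → ¬ (R ≅ʳ ℤ₂× D)) →
                           TotalDominationBounded
  totalDominationBounded not-ℤ₂×D X X-dom with any? primitivePair-resp primitivePair?
  ... | yes (e , e-prim , f-prim) = WithPrimitivePair.bounded not-ℤ₂×D e-prim f-prim X X-dom
  ... | no  no-pair               = WithoutPrimitivePair.bounded (λ e pair → no-pair (e , pair)) X X-dom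

corollary4p4 : ∀ {c ℓ} (R : CommutativeRing c ℓ) → Finite R →
    (∀ (D : CommutativeRing c ℓ) → IsIntegralDomain D → ¬ (R ≅ʳ ℤ₂× D)) →
    ∀ (k : ℕ) →
      (ZeroDivisorGraph.IsDominationNumber R k → ZeroDivisorGraph.IsTotalDominationNumber R k) ×
      (ZeroDivisorGraph.IsTotalDominationNumber R k → ZeroDivisorGraph.IsDominationNumber R k)
corollary4p4 R (n , enum) not-ℤ₂×D =
  Domination.domination⇔totalDomination R (FiniteZeroDivisorGraph.totalDominationBounded R enum not-ℤ₂×D)
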